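{- Let $p$ be the mesh pattern $(12,R)$ with $R=\{0,1,2\}^2\setminus\{(1,1)\}$, let $E(t,u)=\sum_{n\ge0}t^n\sum_{\sigma\in K_n}u^{p(\sigma)}$, and let $P(t)=\sum_{n\ge0}|K_n(p)|t^n$. Then $$P(t)=\frac{t^2}{1+t}+\frac{(1+2t)A(t)}{(1+t)^2},\qquad E(t,u)=\frac{t^2(1-u)}{1+t}+\frac{(1+2t+ut^2)A(t)}{(1+t)^2}.$$ The initial terms of $E(t,u)$ are $1+t+2t^4+14t^5+(88+2u)t^6+(636+10u)t^7+(5174+68u)t^8+\cdots$.
   Context: A permutation $\sigma=\sigma_1\cdots\sigma_n$ of $\{1,\dots,n\}$ is a king permutation if $|\sigma_{i+1}-\sigma_i|>1$ for all $1\le i\le n-1$. $K_n$ is the set of king permutations of length $n$ ($K_0$ = the empty permutation, $K_1=\{1\}$) and $A(t)=\sum_{n\ge0}|K_n|t^n$ (known to equal $\sum_{n\ge0}n!\,t^n(1-t)^n/(1+t)^n$). For a mesh pattern $p=(12,R)$ with $R\subseteq\{0,1,2\}^2$, an occurrence of $p$ in $\sigma\in S_n$ is a pair of positions $i_1<i_2$ with $\sigma_{i_1}<\sigma_{i_2}$ such that for every $(x,y)\in R$ there is no position $m$ with $i_x<m<i_{x+1}$ and $v_y<\sigma_m<v_{y+1}$, where $i_0=0$, $i_3=n+1$, $v_0=0$, $v_1=\sigma_{i_1}$, $v_2=\sigma_{i_2}$, $v_3=n+1$ (first coordinate of a box indexes positions, second values). $p(\sigma)$ is the number of occurrences of $p$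 in $\sigma$; $K_n(p)$ is the set of king $n$-permutations with $p(\sigma)=0$. -}

module Defs where

open import Data.Bool using (Bool; true; false; _∧_; _∨_; not; if_then_else_)
open import Data.Nat as ℕ using (ℕ; zero; suc; _∸_; _<ᵇ_; _≡ᵇ_; ∣_-_∣)
open import Data.Integer as ℤ using (ℤ; +_; -_; _+_; _*_)
open import Data.Fin using (Fin; toℕ)
open import Data.Vec using (Vec; []; _∷_; lookup; toList)
open import Data.List using (List; []; _∷_; [_]; map; concatMap; allFin; length)
open import Data.Bool.ListAction using (any; all)
open import Data.Product using (_×_; _,_)

count : {A : Set} → (A → Bool) → List A → ℕ
count p []       = 0
count p (x ∷ xs) = if p x then suc (count p xs) else count p xs

allVecs : (m k : ℕ) → List (Vec (Fin m) k)
allVecs m zero    = [ [] ]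
allVecs m (suc k) = concatMap (λ v → map (_∷ v) (allFin m)) (allVecs m k)

-- Permutations of {1..n}: a word σ : Vec (Fin n) n, the entry at
-- position i (i = 1..n) being  1 + toℕ (lookup σ (i-1)).

pos : {n : ℕ} → Fin n → ℕ
pos i = suc (toℕ i)

val : {n : ℕ} → Vec (Fin n) n → Fin n → ℕ
val σ i = suc (toℕ (lookup σ i))

isPerm : {n : ℕ} → Vec (Fin n) n → Bool
isPerm {n} σ = all (λ i → all (λ j → not (val σ i ≡ᵇ val σ j) ∨ (toℕ i ≡ᵇ toℕ j)) (allFin n)) (allFin n)

kingList : List ℕ → Bool
kingList []            = true
kingList (a ∷ [])      = true
kingList (a ∷ b ∷ xs)  = (1 <ᵇ ∣ a - b ∣) ∧ kingList (b ∷ xs)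

isKing : {n : ℕ} → Vec (Fin n) n → Bool
isKing σ = kingList (Data.List.map suc (Data.List.map toℕ (toList σ)))

K : (n : ℕ) → List (Vec (Fin n) n)
K n = Data.List.filterᵇ (λ σ → isPerm σ ∧ isKing σ) (allVecs n n)

_<ᵇ_<ᵇ_ : ℕ → ℕ → ℕ → Bool
a <ᵇ b <ᵇ c = (a <ᵇ b) ∧ (b <ᵇ c)

isOcc12 : {n : ℕ} → List (ℕ × ℕ) → Vec (Fin n) n → Fin n → Fin n → Bool
isOcc12 {n} R σ i₁ i₂ =
  (pos i₁ <ᵇ pos i₂) ∧ (val σ i₁ <ᵇ val σ i₂) ∧ all boxEmpty R
  where
    I : ℕ → ℕ
    I 0 = 0
    I 1 = pos i₁
    I 2 = pos i₂
    I _ = suc n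
    V : ℕ → ℕ
    V 0 = 0
    V 1 = val σ i₁
    V 2 = val σ i₂
    V _ = suc n
    boxEmpty : ℕ × ℕ → Bool
    boxEmpty (x , y) = not (any (λ m → (I x <ᵇ pos m <ᵇ I (suc x)) ∧ (V y <ᵇ val σ m <ᵇ V (suc y))) (allFin n))

occ12 : {n : ℕ} → List (ℕ × ℕ) → Vec (Fin n) n → ℕ
occ12 {n} R σ = count (λ ij → isOcc12 R σ (Data.Product.proj₁ ij) (Data.Product.proj₂ ij))
                      (concatMap (λ i → map (i ,_) (allFin n)) (allFin n))

R34 : List (ℕ × ℕ)
R34 = (0 , 0) ∷ (0 , 1) ∷ (0 , 2) ∷ (1 , 0) ∷ (1 , 2) ∷ (2 , 0) ∷ (2 , 1) ∷ (2 , 2) ∷ []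

-- Formal power series over ℤ: univariate (in t) as ℕ → ℤ,
-- bivariate (in t, u) as ℕ → ℕ → ℤ  (F n k = coefficient of tⁿ uᵏ).

Series : Set
Series = ℕ → ℤ

BSeries : Set
BSeries = ℕ → ℕ → ℤ

sumTo : ℕ → (ℕ → ℤ) → ℤ
sumTo zero    f = f 0
sumTo (suc n) f = sumTo n f + f (suc n)

_⊕_ : Series → Series → Series
(f ⊕ g) n = f n + g n

_⊛_ : Series → Series → Series
(f ⊛ g) n = sumTo n (λ k → f k * g (n ∸ k))

infixl 6 _⊕_ _⊞_
infixl 7 _⊛_ _⊠_

_⊞_ : BSeries → BSeries → BSeries
(F ⊞ G) n k = F n k + G n k

_⊠_ : BSeries → BSeries → BSeries
(F ⊠ G) n k = sumTo n (λ i → sumTo k (λ j → F i j * G (n ∸ i) (k ∸ j)))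

poly : List ℤ → Series
poly []       n       = + 0
poly (c ∷ cs) zero    = c
poly (c ∷ cs) (suc n) = poly cs n

inv1+t : Series
inv1+t zero    = + 1
inv1+t (suc n) = - inv1+t n

lift : Series → BSeries
lift f n zero    = f n
lift f n (suc k) = + 0

uB : BSeries
uB zero (suc zero) = + 1
uB _    _          = + 0

A : Series
A n = + length (K n)

P : Series
P n = + count (λ σ → occ12 R34 σ ≡ᵇ 0) (K n)

E : BSeries
E n k = + count (λ σ → occ12 R34 σ ≡ᵇ k) (K n)

{-# OPTIONS --safe #-}
module Submission where

-- Every cell of the pattern except the middle one is shaded, so (i₁, i₂) is an occurrence in
-- σ ∈ S_n exactly when i₁ = 1, i₂ = n, σ_{i₁} = 1 and σ_{i₂} = n. Hence p(σ) ∈ {0, 1}, P = A − B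
-- and E = A − B + uB, where B(t) counts the king permutations running from 1 to n. Let C(t) count
-- the king permutations ending with their maximum. Deleting that final n leaves a king permutation
-- not ending with n − 1, so (1 + t)C = tA; deleting the initial 1 of a permutation counted by B
-- (and lowering the other values) leaves one counted by C that does not start with 1, so
-- (1 + t)B = tC − t². Thus B = t²A/(1 + t)² − t²/(1 + t), and as (1 + t)² − t² = 1 + 2t both
-- formulas follow.

open import Defs
open import Data.Bool using (Bool; true; false; _∧_; _∨_; not; T; if_then_else_)
open import Data.Bool.ListAction using (all; any)
open import Data.Bool.Properties
  using (T-∧; T-∨; T-≡; T-not-≡; ∧-assoc; ∧-comm; ∧-zeroʳ; ∧-identityʳ
        ; ∨-assoc; ∨-identityʳ; ∨-conicalˡ; ∨-conicalʳ)
open import Data.Empty using (⊥; ⊥-elim)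
open import Data.Fin as Fin using (Fin; zero; suc; toℕ; fromℕ; fromℕ<)
import Data.Fin.Properties as Fin
open import Data.Integer as ℤ using (ℤ; +_; -_; _+_; _-_; _*_)
import Data.Integer.Properties as ℤ
open import Data.Integer.Tactic.RingSolver using (solve-∀)
open import Data.List
  using ( List; []; _∷_; _++_; _∷ʳ_; _∷ʳ′_; initLast; map; length; filterᵇ; concatMap
        ; cartesianProductWith; allFin; tabulate)
open import Data.List.Properties
  using (length-map; length-++; length-++-sucʳ; map-++; map-∘; map-cong; map-tabulate; map-injective
        ; ∷-injectiveʳ; ∷ʳ-injectiveˡ)
open import Data.List.Membership.Propositional using (_∈_; lose)
open import Data.List.Membership.Propositional.Properties
  using (∈-filter⁺; ∈-filter⁻; ∈-map⁺; ∈-map⁻; ∈-∃++; ∈-++⁻; ∈-++⁺ˡ; ∈-++⁺ʳ; ∈-allFin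
        ; ∈-cartesianProductWith⁺; ∈-cartesianProductWith⁻)
open import Data.List.Relation.Binary.Subset.Propositional using (_⊆_)
import Data.List.Relation.Unary.All as All
open All using (All; []; _∷_)
import Data.List.Relation.Unary.All.Properties as AllP
open import Data.List.Relation.Unary.AllPairs using ([]; _∷_)
open import Data.List.Relation.Unary.Any as Any using (here; there)
import Data.List.Relation.Unary.Any.Properties as AnyP
open import Data.List.Relation.Unary.Unique.Propositional using (Unique)
import Data.List.Relation.Unary.Unique.Propositional.Properties as Unique
open import Data.Nat as ℕ using (ℕ; zero; suc; _∸_; _≤_; _<_; z≤n; s≤s; z<s; _≡ᵇ_; _<ᵇ_; ∣_-_∣)
import Data.Nat.Properties as ℕ
open import Data.Product using (_×_; _,_; ∃; ∃₂; proj₁; proj₂)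
open import Data.Sum using (inj₁; inj₂)
open import Data.Vec using (Vec; []; _∷_; toList; lookup)
open import Function using (_∘_; id; const; Equivalence)
open import Function.Definitions using (Injective)
open import Relation.Binary.Definitions using (tri<; tri≈; tri>)
open import Relation.Binary.PropositionalEquality
  using (_≡_; _≢_; refl; sym; trans; cong; cong₂; subst; subst₂; _≗_; module ≡-Reasoning)
open import Relation.Nullary using (¬_; yes; no)
open import Relation.Nullary.Decidable using (T?)

-- Formal power series

sumTo-cong : ∀ n {f g : ℕ → ℤ} → (∀ {k} → k ≤ n → f k ≡ g k) → sumTo n f ≡ sumTo n g
sumTo-cong zero    f≡g = f≡g z≤n
sumTo-cong (suc n) f≡g = cong₂ _+_ (sumTo-cong n (f≡g ∘ ℕ.m≤n⇒m≤1+n)) (f≡g ℕ.≤-refl)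

sumTo-zero : ∀ n {f : ℕ → ℤ} → (∀ {k} → k ≤ n → f k ≡ + 0) → sumTo n f ≡ + 0
sumTo-zero zero    f≡0 = f≡0 z≤n
sumTo-zero (suc n) f≡0 = cong₂ _+_ (sumTo-zero n (f≡0 ∘ ℕ.m≤n⇒m≤1+n)) (f≡0 ℕ.≤-refl)

sumTo-suc : ∀ n (f : ℕ → ℤ) → sumTo (suc n) f ≡ f 0 + sumTo n (f ∘ suc)
sumTo-suc zero    f = refl
sumTo-suc (suc n) f = trans (cong (_+ f (suc (suc n))) (sumTo-suc n f)) (ℤ.+-assoc (f 0) _ _)

sumTo-neg : ∀ n (f : ℕ → ℤ) → sumTo n (λ k → - f k) ≡ - sumTo n f
sumTo-neg zero    f = refl
sumTo-neg (suc n) f = trans (cong (_+ - f (suc n)) (sumTo-neg n f)) (sym (ℤ.neg-distrib-+ (sumTo n f) (f (suc n))))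

sumTo-≡-last : ∀ n {f : ℕ → ℤ} → (∀ {k} → k < n → f k ≡ + 0) → sumTo n f ≡ f n
sumTo-≡-last zero    f≡0 = refl
sumTo-≡-last (suc n) {f} f≡0 =
  trans (cong (_+ f (suc n)) (sumTo-zero n (f≡0 ∘ s≤s))) (ℤ.+-identityˡ (f (suc n)))

sumTo-≡-first : ∀ n {f : ℕ → ℤ} → (∀ k → f (suc k) ≡ + 0) → sumTo n f ≡ f 0
sumTo-≡-first zero    f≡0 = refl
sumTo-≡-first (suc n) {f} f≡0 =
  trans (sumTo-suc n f) (trans (cong (_+_ (f 0)) (sumTo-zero n (λ {k} _ → f≡0 k))) (ℤ.+-identityʳ (f 0)))

shift : Series → Series
shift f zero    = + 0
shift f (suc n) = f n

shift-cong : ∀ {f g} → f ≗ g → shift f ≗ shift g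
shift-cong f≗g zero    = refl
shift-cong f≗g (suc n) = f≗g n

neg : Series → Series
neg f n = - f n

mul1+t : Series → Series
mul1+t f = f ⊕ shift f

one -one t² 1+2t : Series
one  = poly (+ 1 ∷ [])
-one = poly (- + 1 ∷ [])
t²   = poly (+ 0 ∷ + 0 ∷ + 1 ∷ [])
1+2t = poly (+ 1 ∷ + 2 ∷ [])

⊛-congˡ : ∀ {f f′} g → f ≗ f′ → f ⊛ g ≗ f′ ⊛ g
⊛-congˡ g f≗f′ n = sumTo-cong n (λ {k} _ → cong (_* g (n ∸ k)) (f≗f′ k))

⊛-congʳ : ∀ f {g g′} → g ≗ g′ → f ⊛ g ≗ f ⊛ g′
⊛-congʳ f g≗g′ n = sumTo-cong n (λ {k} _ → cong (f k *_) (g≗g′ (n ∸ k)))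

⊛-zeroˡ : ∀ {f} g → f ≗ const (+ 0) → f ⊛ g ≗ const (+ 0)
⊛-zeroˡ g f≗0 n = sumTo-zero n (λ {k} _ → cong (_* g (n ∸ k)) (f≗0 k))

⊛-zeroʳ : ∀ f {g} → g ≗ const (+ 0) → f ⊛ g ≗ const (+ 0)
⊛-zeroʳ f g≗0 n = sumTo-zero n (λ {k} _ → trans (cong (f k *_) (g≗0 (n ∸ k))) (ℤ.*-zeroʳ (f k)))

poly-∷-⊛ : ∀ c cs g n → (poly (c ∷ cs) ⊛ g) (suc n) ≡ c * g (suc n) + (poly cs ⊛ g) n
poly-∷-⊛ c cs g n = sumTo-suc n _

poly-[]-⊛ : ∀ g → poly [] ⊛ g ≗ const (+ 0)
poly-[]-⊛ g = ⊛-zeroˡ g (λ _ → refl)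


poly-[c]-vanishes : ∀ c {m} → 0 < m → poly (c ∷ []) m ≡ + 0
poly-[c]-vanishes c (s≤s _) = refl

⊛-poly-[c] : ∀ f c n → (f ⊛ poly (c ∷ [])) n ≡ f n * c
⊛-poly-[c] f c n = trans (sumTo-≡-last n vanish) (cong (λ m → f n * poly (c ∷ []) m) (ℕ.n∸n≡0 n))
  where
  vanish : ∀ {k} → k < n → f k * poly (c ∷ []) (n ∸ k) ≡ + 0
  vanish {k} k<n = trans (cong (f k *_) (poly-[c]-vanishes c (ℕ.m<n⇒0<n∸m k<n))) (ℤ.*-zeroʳ (f k))

poly-[c]-⊛ : ∀ c g n → (poly (c ∷ []) ⊛ g) n ≡ c * g n
poly-[c]-⊛ c g zero    = refl
poly-[c]-⊛ c g (suc n) =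
  trans (poly-∷-⊛ c [] g n) (trans (cong (_+_ (c * g (suc n))) (poly-[]-⊛ g n)) (ℤ.+-identityʳ _))

⊛-one : ∀ f → f ⊛ one ≗ f
⊛-one f n = trans (⊛-poly-[c] f (+ 1) n) (ℤ.*-identityʳ (f n))

one-⊛ : ∀ g → one ⊛ g ≗ g
one-⊛ g n = trans (poly-[c]-⊛ (+ 1) g n) (ℤ.*-identityˡ (g n))

t²-⊛ : ∀ g → t² ⊛ g ≗ shift (shift g)
t²-⊛ g zero          = refl
t²-⊛ g (suc zero)    = refl
t²-⊛ g (suc (suc n)) = begin
  (t² ⊛ g) (suc (suc n))                            ≡⟨ poly-∷-⊛ (+ 0) (+ 0 ∷ + 1 ∷ []) g (suc n) ⟩
  + 0 + (poly (+ 0 ∷ + 1 ∷ []) ⊛ g) (suc n)         ≡⟨ cong (_+_ (+ 0)) (poly-∷-⊛ (+ 0) (+ 1 ∷ []) g n) ⟩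
  + 0 + (+ 0 + (one ⊛ g) n)                         ≡⟨ cong (λ x → + 0 + (+ 0 + x)) (one-⊛ g n) ⟩
  + 0 + (+ 0 + g n)                                 ≡⟨ trans (ℤ.+-identityˡ _) (ℤ.+-identityˡ (g n)) ⟩
  g n                                               ∎
  where open ≡-Reasoning

1+2t-⊛ : ∀ g → 1+2t ⊛ g ≗ g ⊕ shift g ⊕ shift g
1+2t-⊛ g zero    = lemma (g 0)
  where
  lemma : ∀ a → + 1 * a ≡ a + + 0 + + 0
  lemma = solve-∀
1+2t-⊛ g (suc n) = begin
  (1+2t ⊛ g) (suc n)                                ≡⟨ poly-∷-⊛ (+ 1) (+ 2 ∷ []) g n ⟩
  + 1 * g (suc n) + (poly (+ 2 ∷ []) ⊛ g) n         ≡⟨ cong (_+_ (+ 1 * g (suc n))) (poly-[c]-⊛ (+ 2) g n) ⟩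
  + 1 * g (suc n) + + 2 * g n                       ≡⟨ lemma (g (suc n)) (g n) ⟩
  g (suc n) + g n + g n                             ∎
  where
  open ≡-Reasoning
  lemma : ∀ a b → + 1 * a + + 2 * b ≡ a + b + b
  lemma = solve-∀

div1+t : Series → Series
div1+t f zero    = f zero
div1+t f (suc n) = f (suc n) - div1+t f n

div1+t-step : ∀ f n → div1+t f (suc n) + div1+t f n ≡ f (suc n)
div1+t-step f n = lemma (f (suc n)) (div1+t f n)
  where
  lemma : ∀ a b → a - b + b ≡ a
  lemma = solve-∀

div1+t-unique : ∀ g f → g 0 ≡ f 0 → (∀ n → g (suc n) + g n ≡ f (suc n)) → g ≗ div1+t f
div1+t-unique g f g₀ step zero    = g₀
div1+t-unique g f g₀ step (suc n) = begin
  g (suc n)                         ≡⟨ lemma (g (suc n)) (g n) ⟩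
  g (suc n) + g n - g n             ≡⟨ cong₂ _-_ (step n) (div1+t-unique g f g₀ step n) ⟩
  f (suc n) - div1+t f n            ∎
  where
  open ≡-Reasoning
  lemma : ∀ a b → a ≡ a + b - b
  lemma = solve-∀

div1+t-cong : ∀ {f g} → f ≗ g → div1+t f ≗ div1+t g
div1+t-cong f≗g zero    = f≗g zero
div1+t-cong f≗g (suc n) = cong₂ _-_ (f≗g (suc n)) (div1+t-cong f≗g n)

div1+t-zero : ∀ {f} → f ≗ const (+ 0) → div1+t f ≗ const (+ 0)
div1+t-zero {f} f≗0 n = sym (div1+t-unique (const (+ 0)) f (sym (f≗0 0)) (λ m → sym (f≗0 (suc m))) n)

div1+t-⊕ : ∀ f g → div1+t (f ⊕ g) ≗ div1+t f ⊕ div1+t g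
div1+t-⊕ f g n = sym (div1+t-unique (div1+t f ⊕ div1+t g) (f ⊕ g) refl step n)
  where
  lemma : ∀ a b c d → (a + b) + (c + d) ≡ (a + c) + (b + d)
  lemma = solve-∀
  step : ∀ n → (div1+t f ⊕ div1+t g) (suc n) + (div1+t f ⊕ div1+t g) n ≡ (f ⊕ g) (suc n)
  step n = trans (lemma (div1+t f (suc n)) (div1+t g (suc n)) (div1+t f n) (div1+t g n))
                 (cong₂ _+_ (div1+t-step f n) (div1+t-step g n))

div1+t-neg : ∀ f → div1+t (neg f) ≗ neg (div1+t f)
div1+t-neg f n = sym (div1+t-unique (neg (div1+t f)) (neg f) refl step n)
  where
  step : ∀ n → - div1+t f (suc n) + - div1+t f n ≡ - f (suc n)
  step n = trans (sym (ℤ.neg-distrib-+ (div1+t f (suc n)) (div1+t f n))) (cong -_ (div1+t-step f n))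

div1+t-shift : ∀ f → div1+t (shift f) ≗ shift (div1+t f)
div1+t-shift f n = sym (div1+t-unique (shift (div1+t f)) (shift f) refl step n)
  where
  step : ∀ n → shift (div1+t f) (suc n) + shift (div1+t f) n ≡ shift f (suc n)
  step zero    = ℤ.+-identityʳ (f 0)
  step (suc n) = div1+t-step f n

div1+t-mul1+t : ∀ f → div1+t (mul1+t f) ≗ f
div1+t-mul1+t f n = sym (div1+t-unique f (mul1+t f) (sym (ℤ.+-identityʳ (f 0))) (λ _ → refl) n)

⊛-inv1+t : ∀ f → f ⊛ inv1+t ≗ div1+t f
⊛-inv1+t f = div1+t-unique (f ⊛ inv1+t) f (ℤ.*-identityʳ (f 0)) step
  where
  S : ℕ → ℤ
  S n = (f ⊛ inv1+t) n
  alternate : ∀ n → sumTo n (λ k → f k * inv1+t (suc n ∸ k)) ≡ - S n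
  alternate n = trans (sumTo-cong n flip) (sumTo-neg n _)
    where
    flip : ∀ {k} → k ≤ n → f k * inv1+t (suc n ∸ k) ≡ - (f k * inv1+t (n ∸ k))
    flip {k} k≤n = trans (cong (λ m → f k * inv1+t m) (ℕ.+-∸-assoc 1 k≤n))
                         (sym (ℤ.neg-distribʳ-* (f k) (inv1+t (n ∸ k))))
  step : ∀ n → S (suc n) + S n ≡ f (suc n)
  step n = begin
    sumTo n (λ k → f k * inv1+t (suc n ∸ k)) + f (suc n) * inv1+t (n ∸ n) + S n
      ≡⟨ cong₂ (λ x m → x + f (suc n) * inv1+t m + S n) (alternate n) (ℕ.n∸n≡0 n) ⟩
    - S n + f (suc n) * + 1 + S n
      ≡⟨ lemma (S n) (f (suc n)) ⟩
    f (suc n) ∎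
    where
    open ≡-Reasoning
    lemma : ∀ a b → - a + b * + 1 + a ≡ b
    lemma = solve-∀

column : BSeries → ℕ → Series
column F k n = F n k

lift-vanishes : ∀ g {n k} → 0 < k → lift g n k ≡ + 0
lift-vanishes g (s≤s _) = refl

column-⊠-lift : ∀ F g k → column (F ⊠ lift g) k ≗ column F k ⊛ g
column-⊠-lift F g k n = sumTo-cong n (λ {i} _ → onlyLast i)
  where
  onlyLast : ∀ i → sumTo k (λ j → F i j * lift g (n ∸ i) (k ∸ j)) ≡ F i k * g (n ∸ i)
  onlyLast i = trans (sumTo-≡-last k vanish) (cong (λ m → F i k * lift g (n ∸ i) m) (ℕ.n∸n≡0 k))
    where
    vanish : ∀ {j} → j < k → F i j * lift g (n ∸ i) (k ∸ j) ≡ + 0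
    vanish {j} j<k = trans (cong (F i j *_) (lift-vanishes g (ℕ.m<n⇒0<n∸m j<k))) (ℤ.*-zeroʳ (F i j))

column-lift-⊠ : ∀ g F k → column (lift g ⊠ F) k ≗ g ⊛ column F k
column-lift-⊠ g F k n = sumTo-cong n (λ _ → sumTo-≡-first k (λ _ → refl))

column-⊠-inv1+t : ∀ F k → column (F ⊠ lift inv1+t) k ≗ div1+t (column F k)
column-⊠-inv1+t F k n = trans (column-⊠-lift F inv1+t k n) (⊛-inv1+t (column F k) n)

column-uB-0 : column uB 0 ≗ const (+ 0)
column-uB-0 zero    = refl
column-uB-0 (suc n) = refl

column-uB-1 : column uB 1 ≗ one
column-uB-1 zero    = refl
column-uB-1 (suc n) = refl

column-uB-2+ : ∀ k → column uB (suc (suc k)) ≗ const (+ 0)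
column-uB-2+ k zero    = refl
column-uB-2+ k (suc n) = refl

1-u 1+2t+ut² closedE : BSeries
1-u      = lift one ⊞ lift -one ⊠ uB
1+2t+ut² = lift 1+2t ⊞ uB ⊠ lift t²
closedE      = lift t² ⊠ 1-u ⊠ lift inv1+t ⊞ 1+2t+ut² ⊠ lift A ⊠ lift inv1+t ⊠ lift inv1+t

column-1-u-0 : column 1-u 0 ≗ one
column-1-u-0 n = trans (cong (_+_ (one n)) (trans (column-lift-⊠ -one uB 0 n) (⊛-zeroʳ -one column-uB-0 n)))
                       (ℤ.+-identityʳ (one n))

column-1-u-1 : column 1-u 1 ≗ -one
column-1-u-1 n = begin
  + 0 + (lift -one ⊠ uB) n 1  ≡⟨ ℤ.+-identityˡ _ ⟩
  (lift -one ⊠ uB) n 1        ≡⟨ column-lift-⊠ -one uB 1 n ⟩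
  (-one ⊛ column uB 1) n      ≡⟨ ⊛-congʳ -one column-uB-1 n ⟩
  (-one ⊛ one) n              ≡⟨ ⊛-one -one n ⟩
  -one n                      ∎
  where open ≡-Reasoning

column-1-u-2+ : ∀ k → column 1-u (suc (suc k)) ≗ const (+ 0)
column-1-u-2+ k n = trans (ℤ.+-identityˡ _) (trans (column-lift-⊠ -one uB _ n) (⊛-zeroʳ -one (column-uB-2+ k) n))

column-1+2t+ut²-0 : column 1+2t+ut² 0 ≗ 1+2t
column-1+2t+ut²-0 n = trans (cong (_+_ (1+2t n)) (trans (column-⊠-lift uB t² 0 n) (⊛-zeroˡ t² column-uB-0 n)))
                            (ℤ.+-identityʳ (1+2t n))

column-1+2t+ut²-1 : column 1+2t+ut² 1 ≗ t²
column-1+2t+ut²-1 n = begin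
  + 0 + (uB ⊠ lift t²) n 1    ≡⟨ ℤ.+-identityˡ _ ⟩
  (uB ⊠ lift t²) n 1          ≡⟨ column-⊠-lift uB t² 1 n ⟩
  (column uB 1 ⊛ t²) n        ≡⟨ ⊛-congˡ t² column-uB-1 n ⟩
  (one ⊛ t²) n                ≡⟨ one-⊛ t² n ⟩
  t² n                        ∎
  where open ≡-Reasoning

column-1+2t+ut²-2+ : ∀ k → column 1+2t+ut² (suc (suc k)) ≗ const (+ 0)
column-1+2t+ut²-2+ k n = trans (ℤ.+-identityˡ _) (trans (column-⊠-lift uB t² _ n) (⊛-zeroˡ t² (column-uB-2+ k) n))

column-closedE : ∀ k → column closedE k ≗ div1+t (t² ⊛ column 1-u k) ⊕ div1+t (div1+t (column 1+2t+ut² k ⊛ A))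
column-closedE k n = cong₂ _+_
  (trans (column-⊠-inv1+t (lift t² ⊠ 1-u) k n) (div1+t-cong (column-lift-⊠ t² 1-u k) n))
  (trans (column-⊠-inv1+t (1+2t+ut² ⊠ lift A ⊠ lift inv1+t) k n)
         (div1+t-cong (λ m → trans (column-⊠-inv1+t (1+2t+ut² ⊠ lift A) k m)
                                   (div1+t-cong (column-⊠-lift 1+2t+ut² A k) m)) n))

closedE-column-0 : column closedE 0 ≗ div1+t t² ⊕ div1+t (div1+t (1+2t ⊛ A))
closedE-column-0 n = trans (column-closedE 0 n) (cong₂ _+_
  (div1+t-cong (λ m → trans (⊛-congʳ t² column-1-u-0 m) (⊛-one t² m)) n)
  (div1+t-cong (div1+t-cong (⊛-congˡ A column-1+2t+ut²-0)) n))

closedE-column-1 : column closedE 1 ≗ div1+t (neg t²) ⊕ div1+t (div1+t (t² ⊛ A))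
closedE-column-1 n = trans (column-closedE 1 n) (cong₂ _+_
  (div1+t-cong (λ m → trans (⊛-congʳ t² column-1-u-1 m) (trans (⊛-poly-[c] t² (- + 1) m) (times-1 (t² m)))) n)
  (div1+t-cong (div1+t-cong (⊛-congˡ A column-1+2t+ut²-1)) n))
  where
  times-1 : ∀ x → x * - + 1 ≡ - x
  times-1 = solve-∀

closedE-column-2+ : ∀ k → column closedE (suc (suc k)) ≗ const (+ 0)
closedE-column-2+ k n = trans (column-closedE (suc (suc k)) n) (cong₂ _+_
  (div1+t-zero (⊛-zeroʳ t² (column-1-u-2+ k)) n)
  (div1+t-zero (div1+t-zero (⊛-zeroˡ A (column-1+2t+ut²-2+ k))) n))

closedP : Series
closedP = t² ⊛ inv1+t ⊕ 1+2t ⊛ A ⊛ inv1+t ⊛ inv1+t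

closedP-as-div1+t : closedP ≗ div1+t t² ⊕ div1+t (div1+t (1+2t ⊛ A))
closedP-as-div1+t n = cong₂ _+_ (⊛-inv1+t t² n)
  (trans (⊛-inv1+t (1+2t ⊛ A ⊛ inv1+t) n) (div1+t-cong (⊛-inv1+t (1+2t ⊛ A)) n))

square-split : ∀ g → g ≗ div1+t (div1+t (1+2t ⊛ g)) ⊕ div1+t (div1+t (t² ⊛ g))
square-split g n = begin
  g n
    ≡⟨ trans (div1+t-cong (div1+t-mul1+t (mul1+t g)) n) (div1+t-mul1+t g n) ⟨
  div1+t (div1+t (mul1+t (mul1+t g))) n
    ≡⟨ div1+t-cong (div1+t-cong expand) n ⟩
  div1+t (div1+t (1+2t ⊛ g ⊕ t² ⊛ g)) n
    ≡⟨ trans (div1+t-cong (div1+t-⊕ (1+2t ⊛ g) (t² ⊛ g)) n) (div1+t-⊕ (div1+t (1+2t ⊛ g)) (div1+t (t² ⊛ g)) n) ⟩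
  div1+t (div1+t (1+2t ⊛ g)) n + div1+t (div1+t (t² ⊛ g)) n
    ∎
  where
  open ≡-Reasoning
  expand : mul1+t (mul1+t g) ≗ 1+2t ⊛ g ⊕ t² ⊛ g
  expand zero    = trans (lemma₀ (g 0)) (sym (cong₂ _+_ (1+2t-⊛ g 0) (t²-⊛ g 0)))
    where
    lemma₀ : ∀ a → a + + 0 + + 0 ≡ a + + 0 + + 0 + + 0
    lemma₀ = solve-∀
  expand (suc m) = trans (lemma (g (suc m)) (g m) (shift g m)) (sym (cong₂ _+_ (1+2t-⊛ g (suc m)) (t²-⊛ g (suc m))))
    where
    lemma : ∀ a b c → a + b + (b + c) ≡ a + b + b + c
    lemma = solve-∀

private
  variable
    X Y Z : Set

T-∧⁻ : ∀ a {b} → T (a ∧ b) → T a × T b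
T-∧⁻ a = Equivalence.to (T-∧ {a})

T-not⇒¬T : ∀ {b} → T (not b) → ¬ T b
T-not⇒¬T {true}  ()
T-not⇒¬T {false} _ ()

¬T⇒T-not : ∀ {b} → ¬ T b → T (not b)
¬T⇒T-not {true}  ¬b = ¬b _
¬T⇒T-not {false} _  = _

T-injective : ∀ {a b} → (T a → T b) → (T b → T a) → a ≡ b
T-injective {false} {false} _ _ = refl
T-injective {false} {true}  _ g = ⊥-elim (g _)
T-injective {true}  {false} f _ = ⊥-elim (f _)
T-injective {true}  {true}  _ _ = refl


count-cong : ∀ {p q : X → Bool} xs → (∀ {x} → x ∈ xs → p x ≡ q x) → count p xs ≡ count q xs
count-cong []       p≡q = refl
count-cong {q = q} (x ∷ xs) p≡q rewrite p≡q (here refl) with q x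
... | true  = cong suc (count-cong xs (p≡q ∘ there))
... | false = count-cong xs (p≡q ∘ there)

count-none : ∀ {p : X → Bool} xs → (∀ x → p x ≡ false) → count p xs ≡ 0
count-none []       p≡false = refl
count-none (x ∷ xs) p≡false rewrite p≡false x = count-none xs p≡false

count-true : ∀ (xs : List X) → count (const true) xs ≡ length xs
count-true []       = refl
count-true (x ∷ xs) = cong suc (count-true xs)

count-++ : ∀ (p : X → Bool) xs ys → count p (xs ++ ys) ≡ count p xs ℕ.+ count p ys
count-++ p []       ys = refl
count-++ p (x ∷ xs) ys with p x
... | true  = cong suc (count-++ p xs ys)
... | false = count-++ p xs ys

count-map : ∀ (p : Y → Bool) (f : X → Y) xs → count p (map f xs) ≡ count (p ∘ f) xs
count-map p f []       = refl
count-map p f (x ∷ xs) with p (f x)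
... | true  = cong suc (count-map p f xs)
... | false = count-map p f xs

count-filterᵇ : ∀ (p q : X → Bool) xs → count p (filterᵇ q xs) ≡ count (λ x → q x ∧ p x) xs
count-filterᵇ p q []       = refl
count-filterᵇ p q (x ∷ xs) with q x
... | false = count-filterᵇ p q xs
... | true with p x
...   | true  = cong suc (count-filterᵇ p q xs)
...   | false = count-filterᵇ p q xs

length-filterᵇ : ∀ (p : X → Bool) xs → length (filterᵇ p xs) ≡ count p xs
length-filterᵇ p []       = refl
length-filterᵇ p (x ∷ xs) with p x
... | true  = cong suc (length-filterᵇ p xs)
... | false = length-filterᵇ p xs

count-split : ∀ (p q : X → Bool) xs →
              count p xs ≡ count (λ x → p x ∧ q x) xs ℕ.+ count (λ x → p x ∧ not (q x)) xs
count-split p q []       = refl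
count-split p q (x ∷ xs) with p x | q x
... | true  | true  = cong suc (count-split p q xs)
... | true  | false = trans (cong suc (count-split p q xs)) (sym (ℕ.+-suc _ _))
... | false | _     = count-split p q xs

Unique⇒length≤ : ∀ {xs ys : List X} → Unique xs → xs ⊆ ys → length xs ≤ length ys
Unique⇒length≤ {xs = []}     _               _     = z≤n
Unique⇒length≤ {xs = x ∷ xs} (x∉xs ∷ unique) xs⊆ys with us , vs , refl ← ∈-∃++ (xs⊆ys (here refl)) =
  ℕ.≤-trans (s≤s (Unique⇒length≤ unique (removeX ∘ λ z∈xs → z∈xs , All.lookup x∉xs z∈xs)))
            (ℕ.≤-reflexive (sym (length-++-sucʳ us x vs)))
  where
  removeX : ∀ {z} → z ∈ xs × x ≢ z → z ∈ us ++ vs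
  removeX (z∈xs , x≢z) with ∈-++⁻ us (xs⊆ys (there z∈xs))
  ... | inj₁ z∈us         = ∈-++⁺ˡ z∈us
  ... | inj₂ (here z≡x)   = ⊥-elim (x≢z (sym z≡x))
  ... | inj₂ (there z∈vs) = ∈-++⁺ʳ us z∈vs

count-≡-by-injection : ∀ (p : X → Bool) (q : Y → Bool) (g : Y → X) {xs ys} →
  Injective _≡_ _≡_ g → Unique xs → Unique ys →
  (∀ {y} → y ∈ ys → g y ∈ xs × p (g y) ≡ q y) →
  (∀ {x} → x ∈ xs → T (p x) → ∃ λ y → y ∈ ys × g y ≡ x) →
  count p xs ≡ count q ys
count-≡-by-injection p q g {xs} {ys} g-inj xs! ys! into onto = begin
  count p xs                          ≡⟨ length-filterᵇ p xs ⟨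
  length (filterᵇ p xs)               ≡⟨ ℕ.≤-antisym (Unique⇒length≤ P! P⊆G) (Unique⇒length≤ G! G⊆P) ⟩
  length (map g (filterᵇ q ys))       ≡⟨ length-map g (filterᵇ q ys) ⟩
  length (filterᵇ q ys)               ≡⟨ length-filterᵇ q ys ⟩
  count q ys                          ∎
  where
  open ≡-Reasoning
  P! : Unique (filterᵇ p xs)
  P! = Unique.filter⁺ (T? ∘ p) xs!
  G! : Unique (map g (filterᵇ q ys))
  G! = Unique.map⁺ g-inj (Unique.filter⁺ (T? ∘ q) ys!)
  P⊆G : filterᵇ p xs ⊆ map g (filterᵇ q ys)
  P⊆G x∈ with x∈xs , px ← ∈-filter⁻ (T? ∘ p) x∈ with y , y∈ys , refl ← onto x∈xs px =
    ∈-map⁺ g (∈-filter⁺ (T? ∘ q) y∈ys (subst T (proj₂ (into y∈ys)) px))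
  G⊆P : map g (filterᵇ q ys) ⊆ filterᵇ p xs
  G⊆P z∈ with y , y∈ , refl ← ∈-map⁻ g z∈ with y∈ys , qy ← ∈-filter⁻ (T? ∘ q) y∈ =
    ∈-filter⁺ (T? ∘ p) (proj₁ (into y∈ys)) (subst T (sym (proj₂ (into y∈ys))) qy)

concatMap-map : ∀ (f : X → Y → Z) xs ys → concatMap (λ x → map (f x) ys) xs ≡ cartesianProductWith f xs ys
concatMap-map f []       ys = refl
concatMap-map f (x ∷ xs) ys = cong (map (f x) ys ++_) (concatMap-map f xs ys)

map-cartesianProductWith : ∀ {X′ Y′ Z′ : Set} {f : X → Y → Z} {f′ : X′ → Y′ → Z′}
  (h : Z → Z′) (g : X → X′) (g′ : Y → Y′) → (∀ x y → h (f x y) ≡ f′ (g x) (g′ y)) →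
  ∀ xs ys → map h (cartesianProductWith f xs ys) ≡ cartesianProductWith f′ (map g xs) (map g′ ys)
map-cartesianProductWith h g g′ natural []       ys = refl
map-cartesianProductWith {f = f} {f′} h g g′ natural (x ∷ xs) ys = begin
  map h (map (f x) ys ++ cartesianProductWith f xs ys)
    ≡⟨ map-++ h (map (f x) ys) _ ⟩
  map h (map (f x) ys) ++ map h (cartesianProductWith f xs ys)
    ≡⟨ cong₂ _++_ (trans (sym (map-∘ ys)) (trans (map-cong (natural x) ys) (map-∘ ys)))
                  (map-cartesianProductWith h g g′ natural xs ys) ⟩
  map (f′ (g x)) (map g′ ys) ++ cartesianProductWith f′ (map g xs) (map g′ ys)
    ∎
  where open ≡-Reasoning

digits : ℕ → List ℕ
digits m = map toℕ (allFin m)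

∈-digits⁺ : ∀ {m x} → x < m → x ∈ digits m
∈-digits⁺ {m} x<m = subst (_∈ digits m) (Fin.toℕ-fromℕ< x<m) (∈-map⁺ toℕ (∈-allFin (fromℕ< x<m)))

∈-digits⁻ : ∀ {m x} → x ∈ digits m → x < m
∈-digits⁻ x∈ with i , _ , refl ← ∈-map⁻ toℕ x∈ = Fin.toℕ<n i

words : ℕ → ℕ → List (List ℕ)
words m zero    = [] ∷ []
words m (suc k) = cartesianProductWith (λ w x → x ∷ w) (words m k) (digits m)

∈-words⁻ : ∀ {m} k {l} → l ∈ words m k → length l ≡ k × All (_< m) l
∈-words⁻ zero    (here refl) = refl , []
∈-words⁻ {m} (suc k) l∈
  with w , x , w∈ , x∈ , refl ← ∈-cartesianProductWith⁻ (λ w x → x ∷ w) (words m k) (digits m) l∈ =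
  let length≡ , small = ∈-words⁻ k w∈ in cong suc length≡ , ∈-digits⁻ x∈ ∷ small

∈-words⁺ : ∀ {m} k {l} → length l ≡ k → All (_< m) l → l ∈ words m k
∈-words⁺ zero    {[]}    _       _             = here refl
∈-words⁺ (suc k) {x ∷ l} length≡ (x<m ∷ small) =
  ∈-cartesianProductWith⁺ (λ w x → x ∷ w) (∈-words⁺ k (ℕ.suc-injective length≡) small) (∈-digits⁺ x<m)

words-unique : ∀ m k → Unique (words m k)
words-unique m zero    = [] ∷ []
words-unique m (suc k) = Unique.cartesianProductWith⁺ (λ w x → x ∷ w) swap-injective
  (words-unique m k) (Unique.map⁺ Fin.toℕ-injective (Unique.allFin⁺ m))
  where
  swap-injective : ∀ {w w′ x x′} → x ∷ w ≡ x′ ∷ w′ → w ≡ w′ × x ≡ x′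
  swap-injective refl = refl , refl

-- a permutation is encoded as the word of its values minus one, i.e. over {0, …, n − 1}
toWord : ∀ {m k} → Vec (Fin m) k → List ℕ
toWord σ = map toℕ (toList σ)

map-toWord-allVecs : ∀ m k → map toWord (allVecs m k) ≡ words m k
map-toWord-allVecs m zero    = refl
map-toWord-allVecs m (suc k) = begin
  map toWord (concatMap (λ v → map (_∷ v) (allFin m)) (allVecs m k))
    ≡⟨ cong (map toWord) (concatMap-map (λ v i → i ∷ v) (allVecs m k) (allFin m)) ⟩
  map toWord (cartesianProductWith (λ v i → i ∷ v) (allVecs m k) (allFin m))
    ≡⟨ map-cartesianProductWith toWord toWord toℕ (λ _ _ → refl) (allVecs m k) (allFin m) ⟩
  cartesianProductWith (λ w x → x ∷ w) (map toWord (allVecs m k)) (digits m)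
    ≡⟨ cong (λ ws → cartesianProductWith (λ w x → x ∷ w) ws (digits m)) (map-toWord-allVecs m k) ⟩
  words m (suc k)
    ∎
  where open ≡-Reasoning

-- King words

elemᵇ : ℕ → List ℕ → Bool
elemᵇ x []       = false
elemᵇ x (y ∷ ys) = (x ≡ᵇ y) ∨ elemᵇ x ys

distinctᵇ : List ℕ → Bool
distinctᵇ []       = true
distinctᵇ (x ∷ xs) = not (elemᵇ x xs) ∧ distinctᵇ xs

isKingWord : List ℕ → Bool
isKingWord l = distinctᵇ l ∧ kingList l

headIs : ℕ → List ℕ → Bool
headIs v []      = false
headIs v (x ∷ _) = x ≡ᵇ v

lastIs : ℕ → List ℕ → Bool
lastIs v []          = false
lastIs v (x ∷ [])    = x ≡ᵇ v
lastIs v (x ∷ y ∷ l) = lastIs v (y ∷ l)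

elemᵇ-map-suc : ∀ x τ → elemᵇ (suc x) (map suc τ) ≡ elemᵇ x τ
elemᵇ-map-suc x []      = refl
elemᵇ-map-suc x (y ∷ τ) = cong ((x ≡ᵇ y) ∨_) (elemᵇ-map-suc x τ)

elemᵇ-0-map-suc : ∀ τ → elemᵇ 0 (map suc τ) ≡ false
elemᵇ-0-map-suc []      = refl
elemᵇ-0-map-suc (y ∷ τ) = elemᵇ-0-map-suc τ

distinctᵇ-map-suc : ∀ τ → distinctᵇ (map suc τ) ≡ distinctᵇ τ
distinctᵇ-map-suc []      = refl
distinctᵇ-map-suc (x ∷ τ) = cong₂ (λ e d → not e ∧ d) (elemᵇ-map-suc x τ) (distinctᵇ-map-suc τ)

kingList-map-suc : ∀ τ → kingList (map suc τ) ≡ kingList τ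
kingList-map-suc []          = refl
kingList-map-suc (x ∷ [])    = refl
kingList-map-suc (x ∷ y ∷ τ) = cong ((1 <ᵇ ∣ x - y ∣) ∧_) (kingList-map-suc (y ∷ τ))

lastIs-map-suc : ∀ v τ → lastIs (suc v) (map suc τ) ≡ lastIs v τ
lastIs-map-suc v []          = refl
lastIs-map-suc v (x ∷ [])    = refl
lastIs-map-suc v (x ∷ y ∷ τ) = lastIs-map-suc v (y ∷ τ)

isKingWord-0∷map-suc : ∀ τ → isKingWord (0 ∷ map suc τ) ≡ isKingWord τ ∧ not (headIs 0 τ)
isKingWord-0∷map-suc []      = refl
isKingWord-0∷map-suc (y ∷ τ)
  rewrite elemᵇ-0-map-suc τ | distinctᵇ-map-suc (y ∷ τ) | kingList-map-suc (y ∷ τ) =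
  reorder (distinctᵇ (y ∷ τ)) (kingList (y ∷ τ)) y
  where
  reorder : ∀ d k y → d ∧ ((1 <ᵇ suc y) ∧ k) ≡ (d ∧ k) ∧ not (y ≡ᵇ 0)
  reorder d k zero    = trans (∧-zeroʳ d) (sym (∧-zeroʳ (d ∧ k)))
  reorder d k (suc y) = sym (∧-identityʳ (d ∧ k))

farFromLast : ℕ → List ℕ → Bool
farFromLast v []          = true
farFromLast v (x ∷ [])    = 1 <ᵇ ∣ x - v ∣
farFromLast v (x ∷ y ∷ l) = farFromLast v (y ∷ l)

elemᵇ-∷ʳ : ∀ x τ v → elemᵇ x (τ ∷ʳ v) ≡ elemᵇ x τ ∨ (x ≡ᵇ v)
elemᵇ-∷ʳ x []      v = ∨-identityʳ (x ≡ᵇ v)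
elemᵇ-∷ʳ x (y ∷ τ) v =
  trans (cong ((x ≡ᵇ y) ∨_) (elemᵇ-∷ʳ x τ v)) (sym (∨-assoc (x ≡ᵇ y) (elemᵇ x τ) (x ≡ᵇ v)))

elemᵇ-absent : ∀ {v} τ → All (_< v) τ → elemᵇ v τ ≡ false
elemᵇ-absent []      []           = refl
elemᵇ-absent (x ∷ τ) (x<v ∷ τ<v) = cong₂ _∨_ (>⇒≡ᵇ-false x<v) (elemᵇ-absent τ τ<v)
  where
  >⇒≡ᵇ-false : ∀ {v x} → x < v → (v ≡ᵇ x) ≡ false
  >⇒≡ᵇ-false {suc v} {zero}  _         = refl
  >⇒≡ᵇ-false {suc v} {suc x} (s≤s x<v) = >⇒≡ᵇ-false x<v

≡ᵇ-refl : ∀ n → (n ≡ᵇ n) ≡ true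
≡ᵇ-refl n = Equivalence.to T-≡ (ℕ.≡⇒≡ᵇ n n refl)

≡ᵇ-sym : ∀ x y → (x ≡ᵇ y) ≡ (y ≡ᵇ x)
≡ᵇ-sym zero    zero    = refl
≡ᵇ-sym zero    (suc y) = refl
≡ᵇ-sym (suc x) zero    = refl
≡ᵇ-sym (suc x) (suc y) = ≡ᵇ-sym x y

distinctᵇ-∷ʳ : ∀ τ v → distinctᵇ (τ ∷ʳ v) ≡ distinctᵇ τ ∧ not (elemᵇ v τ)
distinctᵇ-∷ʳ []      v = refl
distinctᵇ-∷ʳ (x ∷ τ) v rewrite elemᵇ-∷ʳ x τ v | distinctᵇ-∷ʳ τ v | ≡ᵇ-sym x v =
  reorder (elemᵇ x τ) (v ≡ᵇ x) (distinctᵇ τ) (elemᵇ v τ)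
  where
  reorder : ∀ a b c d → not (a ∨ b) ∧ (c ∧ not d) ≡ (not a ∧ c) ∧ not (b ∨ d)
  reorder true  b     c d = refl
  reorder false true  c d = sym (∧-zeroʳ c)
  reorder false false c d = refl

kingList-∷ʳ : ∀ τ v → kingList (τ ∷ʳ v) ≡ kingList τ ∧ farFromLast v τ
kingList-∷ʳ []          v = refl
kingList-∷ʳ (x ∷ [])    v = ∧-identityʳ (1 <ᵇ ∣ x - v ∣)
kingList-∷ʳ (x ∷ y ∷ τ) v =
  trans (cong ((1 <ᵇ ∣ x - y ∣) ∧_) (kingList-∷ʳ (y ∷ τ) v)) (sym (∧-assoc (1 <ᵇ ∣ x - y ∣) _ _))

farFromLast-max : ∀ m τ → All (_< suc m) τ → farFromLast (suc m) τ ≡ not (lastIs m τ)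
farFromLast-max m []          _               = refl
farFromLast-max m (x ∷ [])    (x<1+m ∷ [])    = farFromMax x m x<1+m
  where
  farFromMax : ∀ x m → x < suc m → (1 <ᵇ ∣ x - suc m ∣) ≡ not (x ≡ᵇ m)
  farFromMax zero    zero    _         = refl
  farFromMax zero    (suc m) _         = refl
  farFromMax (suc x) (suc m) (s≤s x<m) = farFromMax x m x<m
farFromLast-max m (x ∷ y ∷ τ) (_ ∷ τ<1+m) = farFromLast-max m (y ∷ τ) τ<1+m

lastIs-∷ʳ : ∀ v τ x → lastIs v (τ ∷ʳ x) ≡ (x ≡ᵇ v)
lastIs-∷ʳ v []          x = refl
lastIs-∷ʳ v (y ∷ [])    x = refl
lastIs-∷ʳ v (y ∷ z ∷ τ) x = lastIs-∷ʳ v (z ∷ τ) x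

isKingWord-∷ʳ-max : ∀ m τ → All (_< suc m) τ → isKingWord (τ ∷ʳ suc m) ≡ isKingWord τ ∧ not (lastIs m τ)
isKingWord-∷ʳ-max m τ τ<1+m = begin
  isKingWord (τ ∷ʳ suc m)
    ≡⟨ cong₂ _∧_ (distinctᵇ-∷ʳ τ (suc m)) (kingList-∷ʳ τ (suc m)) ⟩
  (distinctᵇ τ ∧ not (elemᵇ (suc m) τ)) ∧ (kingList τ ∧ farFromLast (suc m) τ)
    ≡⟨ cong₂ (λ e f → (distinctᵇ τ ∧ not e) ∧ (kingList τ ∧ f))
             (elemᵇ-absent τ τ<1+m) (farFromLast-max m τ τ<1+m) ⟩
  (distinctᵇ τ ∧ true) ∧ (kingList τ ∧ not (lastIs m τ))
    ≡⟨ cong (_∧ (kingList τ ∧ not (lastIs m τ))) (∧-identityʳ (distinctᵇ τ)) ⟩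
  distinctᵇ τ ∧ (kingList τ ∧ not (lastIs m τ))
    ≡⟨ ∧-assoc (distinctᵇ τ) (kingList τ) (not (lastIs m τ)) ⟨
  isKingWord τ ∧ not (lastIs m τ)
    ∎
  where open ≡-Reasoning

lastIs⇒∷ʳ : ∀ {v} l → T (lastIs v l) → ∃ λ τ → l ≡ τ ∷ʳ v
lastIs⇒∷ʳ {v} l last with initLast l
... | []     = ⊥-elim last
... | τ ∷ʳ′ x = τ , cong (τ ∷ʳ_) (ℕ.≡ᵇ⇒≡ x v (subst T (lastIs-∷ʳ v τ x) last))

length-∷ʳ : ∀ (τ : List ℕ) x → length (τ ∷ʳ x) ≡ suc (length τ)
length-∷ʳ τ x = trans (length-++ τ) (ℕ.+-comm (length τ) 1)

0∉⇒map-suc : ∀ {m} t → All (_< suc m) t → elemᵇ 0 t ≡ false → ∃ λ τ → All (_< m) τ × map suc τ ≡ t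
0∉⇒map-suc []          []                 _   = [] , [] , refl
0∉⇒map-suc (suc x ∷ t) (s≤s x<m ∷ t<1+m) 0∉t =
  let τ , τ<m , map-suc-τ≡t = 0∉⇒map-suc t t<1+m 0∉t in x ∷ τ , x<m ∷ τ<m , cong (suc x ∷_) map-suc-τ≡t

All<1+v∧∉⇒All<v : ∀ {v} τ → All (_< suc v) τ → elemᵇ v τ ≡ false → All (_< v) τ
All<1+v∧∉⇒All<v []      []              _   = []
All<1+v∧∉⇒All<v (x ∷ τ) (x<1+v ∷ τ<1+v) v∉ =
  ℕ.≤∧≢⇒< (ℕ.s≤s⁻¹ x<1+v) x≢v ∷ All<1+v∧∉⇒All<v τ τ<1+v (∨-conicalʳ _ _ v∉)
  where
  x≢v : x ≢ _
  x≢v refl = subst T (∨-conicalˡ _ _ v∉) (ℕ.≡⇒≡ᵇ x x refl)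

count-kingWords-from-0 : ∀ m (r : List ℕ → Bool) →
  count (λ l → isKingWord l ∧ (headIs 0 l ∧ r l)) (words (suc m) (suc m))
  ≡ count (λ τ → isKingWord τ ∧ (not (headIs 0 τ) ∧ r (0 ∷ map suc τ))) (words m m)
count-kingWords-from-0 m r =
  count-≡-by-injection _ _ prepend0 prepend0-injective (words-unique (suc m) (suc m)) (words-unique m m) into onto
  where
  prepend0 : List ℕ → List ℕ
  prepend0 τ = 0 ∷ map suc τ

  prepend0-injective : Injective _≡_ _≡_ prepend0
  prepend0-injective = map-injective ℕ.suc-injective ∘ ∷-injectiveʳ

  into : ∀ {τ} → τ ∈ words m m → prepend0 τ ∈ words (suc m) (suc m)
         × isKingWord (prepend0 τ) ∧ r (prepend0 τ) ≡ isKingWord τ ∧ (not (headIs 0 τ) ∧ r (prepend0 τ))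
  into {τ} τ∈ with length≡ , τ<m ← ∈-words⁻ m τ∈ =
    ∈-words⁺ (suc m) (cong suc (trans (length-map suc τ) length≡)) (s≤s z≤n ∷ AllP.map⁺ (All.map s≤s τ<m)) ,
    trans (cong (_∧ r (prepend0 τ)) (isKingWord-0∷map-suc τ)) (∧-assoc (isKingWord τ) _ _)

  onto : ∀ {l} → l ∈ words (suc m) (suc m) → T (isKingWord l ∧ (headIs 0 l ∧ r l)) →
         ∃ λ τ → τ ∈ words m m × prepend0 τ ≡ l
  onto {h ∷ t} l∈ king∧head∧r
    with length≡ , _ ∷ t<1+m ← ∈-words⁻ (suc m) l∈
       | king , head∧r ← T-∧⁻ (isKingWord (h ∷ t)) king∧head∧r
    with refl ← ℕ.≡ᵇ⇒≡ h 0 (proj₁ (T-∧⁻ (h ≡ᵇ 0) head∧r))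
    with τ , τ<m , refl ← 0∉⇒map-suc t t<1+m
           (Equivalence.to T-not-≡ (proj₁ (T-∧⁻ (not (elemᵇ 0 t)) (proj₁ (T-∧⁻ (distinctᵇ (0 ∷ t)) king)))))
    = τ , ∈-words⁺ m (trans (sym (length-map suc τ)) (ℕ.suc-injective length≡)) τ<m , refl

count-kingWords-to-max : ∀ m →
  count (λ l → isKingWord l ∧ lastIs (suc m) l) (words (suc (suc m)) (suc (suc m)))
  ≡ count (λ τ → isKingWord τ ∧ not (lastIs m τ)) (words (suc m) (suc m))
count-kingWords-to-max m =
  count-≡-by-injection _ _ (_∷ʳ suc m) (∷ʳ-injectiveˡ _ _)
    (words-unique (suc (suc m)) (suc (suc m))) (words-unique (suc m) (suc m)) into onto
  where
  into : ∀ {τ} → τ ∈ words (suc m) (suc m) → τ ∷ʳ suc m ∈ words (suc (suc m)) (suc (suc m))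
         × isKingWord (τ ∷ʳ suc m) ∧ lastIs (suc m) (τ ∷ʳ suc m) ≡ isKingWord τ ∧ not (lastIs m τ)
  into {τ} τ∈ with length≡ , τ<1+m ← ∈-words⁻ (suc m) τ∈ =
    ∈-words⁺ (suc (suc m)) (trans (length-∷ʳ τ (suc m)) (cong suc length≡))
                           (AllP.∷ʳ⁺ (All.map ℕ.m≤n⇒m≤1+n τ<1+m) ℕ.≤-refl) ,
    trans (cong₂ _∧_ (isKingWord-∷ʳ-max m τ τ<1+m) (trans (lastIs-∷ʳ (suc m) τ (suc m)) (≡ᵇ-refl m)))
          (∧-identityʳ _)

  onto : ∀ {l} → l ∈ words (suc (suc m)) (suc (suc m)) → T (isKingWord l ∧ lastIs (suc m) l) →
         ∃ λ τ → τ ∈ words (suc m) (suc m) × τ ∷ʳ suc m ≡ l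
  onto {l} l∈ king∧last
    with king , last ← T-∧⁻ (isKingWord l) king∧last
    with τ , refl ← lastIs⇒∷ʳ {suc m} l last
    with length≡ , τ∷ʳ1+m<2+m ← ∈-words⁻ (suc (suc m)) l∈
    = τ , ∈-words⁺ (suc m) (ℕ.suc-injective (trans (sym (length-∷ʳ τ (suc m))) length≡)) τ<1+m , refl
    where
    1+m∉τ : elemᵇ (suc m) τ ≡ false
    1+m∉τ = Equivalence.to T-not-≡ (proj₂ (T-∧⁻ (distinctᵇ τ)
      (subst T (distinctᵇ-∷ʳ τ (suc m)) (proj₁ (T-∧⁻ (distinctᵇ (τ ∷ʳ suc m)) king)))))
    τ<1+m : All (_< suc m) τ
    τ<1+m = All<1+v∧∉⇒All<v τ (proj₁ (AllP.∷ʳ⁻ τ∷ʳ1+m<2+m)) 1+m∉τ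

-- Recurrences

minToMax : ℕ → List ℕ → Bool
minToMax n l = (1 <ᵇ n) ∧ (headIs 0 l ∧ lastIs (n ∸ 1) l)

kings kingsEndingAtMax kingsFromMinToMax : ℕ → ℕ
kings n             = count isKingWord (words n n)
kingsEndingAtMax n  = count (λ l → isKingWord l ∧ lastIs (n ∸ 1) l) (words n n)
kingsFromMinToMax n = count (λ l → isKingWord l ∧ minToMax n l) (words n n)

kingsEndingAtMax-rec : ∀ m → kingsEndingAtMax (suc m) ℕ.+ kingsEndingAtMax m ≡ kings m
kingsEndingAtMax-rec zero    = refl
kingsEndingAtMax-rec (suc m) = begin
  kingsEndingAtMax (suc (suc m)) ℕ.+ kingsEndingAtMax (suc m)
    ≡⟨ cong (ℕ._+ kingsEndingAtMax (suc m)) (count-kingWords-to-max m) ⟩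
  count (λ τ → isKingWord τ ∧ not (lastIs m τ)) W ℕ.+ kingsEndingAtMax (suc m)
    ≡⟨ ℕ.+-comm _ (kingsEndingAtMax (suc m)) ⟩
  kingsEndingAtMax (suc m) ℕ.+ count (λ τ → isKingWord τ ∧ not (lastIs m τ)) W
    ≡⟨ count-split isKingWord (lastIs m) W ⟨
  kings (suc m)
    ∎
  where
  open ≡-Reasoning
  W = words (suc m) (suc m)

kingsFromMinToMax-rec : ∀ m →
  kingsFromMinToMax (3 ℕ.+ m) ℕ.+ kingsFromMinToMax (2 ℕ.+ m) ≡ kingsEndingAtMax (2 ℕ.+ m)
kingsFromMinToMax-rec m = begin
  kingsFromMinToMax (3 ℕ.+ m) ℕ.+ kingsFromMinToMax (2 ℕ.+ m)
    ≡⟨ cong (ℕ._+ kingsFromMinToMax (2 ℕ.+ m))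
            (trans (count-kingWords-from-0 (2 ℕ.+ m) (lastIs (2 ℕ.+ m))) (count-cong W lastIs-lowered)) ⟩
  count (λ l → isKingWord l ∧ (not (headIs 0 l) ∧ lastIs (suc m) l)) W ℕ.+ kingsFromMinToMax (2 ℕ.+ m)
    ≡⟨ ℕ.+-comm _ (kingsFromMinToMax (2 ℕ.+ m)) ⟩
  kingsFromMinToMax (2 ℕ.+ m) ℕ.+ count (λ l → isKingWord l ∧ (not (headIs 0 l) ∧ lastIs (suc m) l)) W
    ≡⟨ cong₂ ℕ._+_ (count-cong W λ {l} _ → swap (isKingWord l) (lastIs (suc m) l) (headIs 0 l))
                   (count-cong W λ {l} _ → swap (isKingWord l) (lastIs (suc m) l) (not (headIs 0 l))) ⟨
  count (λ l → (isKingWord l ∧ lastIs (suc m) l) ∧ headIs 0 l) W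
    ℕ.+ count (λ l → (isKingWord l ∧ lastIs (suc m) l) ∧ not (headIs 0 l)) W
    ≡⟨ count-split (λ l → isKingWord l ∧ lastIs (suc m) l) (headIs 0) W ⟨
  kingsEndingAtMax (2 ℕ.+ m)
    ∎
  where
  open ≡-Reasoning
  W = words (2 ℕ.+ m) (2 ℕ.+ m)
  swap : ∀ a b c → (a ∧ b) ∧ c ≡ a ∧ (c ∧ b)
  swap a b c = trans (∧-assoc a b c) (cong (a ∧_) (∧-comm b c))
  lastIs-lowered : ∀ {τ} → τ ∈ W → isKingWord τ ∧ (not (headIs 0 τ) ∧ lastIs (2 ℕ.+ m) (0 ∷ map suc τ))
                                  ≡ isKingWord τ ∧ (not (headIs 0 τ) ∧ lastIs (suc m) τ)
  lastIs-lowered {[]}    τ∈ with () ← proj₁ (∈-words⁻ (2 ℕ.+ m) τ∈)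
  lastIs-lowered {y ∷ τ} _  = cong (λ b → isKingWord (y ∷ τ) ∧ (not (y ≡ᵇ 0) ∧ b)) (lastIs-map-suc (suc m) (y ∷ τ))

isPerm⇒distinct-values : ∀ {n} (σ : Vec (Fin n) n) → T (isPerm σ) →
  ∀ i j → T (not (val σ i ≡ᵇ val σ j) ∨ (toℕ i ≡ᵇ toℕ j))
isPerm⇒distinct-values {n} σ perm i j =
  All.lookup (AllP.all⁺ _ (allFin n) (All.lookup (AllP.all⁺ _ (allFin n) perm) (∈-allFin i))) (∈-allFin j)

isPerm⇒injective : ∀ {n} (σ : Vec (Fin n) n) → T (isPerm σ) → Injective _≡_ _≡_ (lookup σ)
isPerm⇒injective σ perm {i} {j} σi≡σj with Equivalence.to T-∨ (isPerm⇒distinct-values σ perm i j)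
... | inj₁ vals≢ = ⊥-elim (T-not⇒¬T vals≢ (ℕ.≡⇒≡ᵇ (val σ i) (val σ j) (cong (suc ∘ toℕ) σi≡σj)))
... | inj₂ i≡j   = Fin.toℕ-injective (ℕ.≡ᵇ⇒≡ (toℕ i) (toℕ j) i≡j)

injective⇒isPerm : ∀ {n} (σ : Vec (Fin n) n) → Injective _≡_ _≡_ (lookup σ) → T (isPerm σ)
injective⇒isPerm {n} σ σ-injective =
  AllP.all⁻ (λ i → all (pairOK i) (allFin n)) {xs = allFin n}
    (All.tabulate λ {i} _ → AllP.all⁻ (pairOK i) {xs = allFin n} (All.tabulate λ {j} _ → pair i j))
  where
  pairOK : Fin n → Fin n → Bool
  pairOK i j = not (val σ i ≡ᵇ val σ j) ∨ (toℕ i ≡ᵇ toℕ j)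
  pair : ∀ i j → T (pairOK i j)
  pair i j with val σ i ≡ᵇ val σ j in vals≡
  ... | false = _
  ... | true  = ℕ.≡⇒≡ᵇ (toℕ i) (toℕ j) (cong toℕ (σ-injective
                  (Fin.toℕ-injective (ℕ.suc-injective (ℕ.≡ᵇ⇒≡ (val σ i) (val σ j) (subst T (sym vals≡) _))))))

elemᵇ-toWord⁺ : ∀ {m k} (v : Vec (Fin m) k) j → T (elemᵇ (toℕ (lookup v j)) (toWord v))
elemᵇ-toWord⁺ (x ∷ v) zero    = Equivalence.from T-∨ (inj₁ (ℕ.≡⇒≡ᵇ (toℕ x) (toℕ x) refl))
elemᵇ-toWord⁺ (x ∷ v) (suc j) = Equivalence.from T-∨ (inj₂ (elemᵇ-toWord⁺ v j))

elemᵇ-toWord⁻ : ∀ {m k} a (v : Vec (Fin m) k) → T (elemᵇ a (toWord v)) → ∃ λ j → a ≡ toℕ (lookup v j)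
elemᵇ-toWord⁻ a (x ∷ v) a∈ with Equivalence.to T-∨ a∈
... | inj₁ a≡x = zero , ℕ.≡ᵇ⇒≡ a (toℕ x) a≡x
... | inj₂ a∈v = let j , a≡vj = elemᵇ-toWord⁻ a v a∈v in suc j , a≡vj

distinctᵇ⇒injective : ∀ {m k} (v : Vec (Fin m) k) → T (distinctᵇ (toWord v)) → Injective _≡_ _≡_ (lookup v)
distinctᵇ⇒injective (x ∷ v) distinct {zero}  {zero}  _    = refl
distinctᵇ⇒injective (x ∷ v) distinct {zero}  {suc j} x≡vj = ⊥-elim (T-not⇒¬T (proj₁ (T-∧⁻ (not _) distinct))
  (subst (λ y → T (elemᵇ (toℕ y) (toWord v))) (sym x≡vj) (elemᵇ-toWord⁺ v j)))
distinctᵇ⇒injective (x ∷ v) distinct {suc i} {zero}  vi≡x = ⊥-elim (T-not⇒¬T (proj₁ (T-∧⁻ (not _) distinct))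
  (subst (λ y → T (elemᵇ (toℕ y) (toWord v))) vi≡x (elemᵇ-toWord⁺ v i)))
distinctᵇ⇒injective (x ∷ v) distinct {suc i} {suc j} vi≡vj =
  cong suc (distinctᵇ⇒injective v (proj₂ (T-∧⁻ (not _) distinct)) vi≡vj)

injective⇒distinctᵇ : ∀ {m k} (v : Vec (Fin m) k) → Injective _≡_ _≡_ (lookup v) → T (distinctᵇ (toWord v))
injective⇒distinctᵇ []      _           = _
injective⇒distinctᵇ (x ∷ v) v-injective =
  Equivalence.from T-∧ (x∉v , injective⇒distinctᵇ v (Fin.suc-injective ∘ v-injective))
  where
  x∉v : T (not (elemᵇ (toℕ x) (toWord v)))
  x∉v with elemᵇ (toℕ x) (toWord v) in x∈v
  ... | false = _
  ... | true with j , x≡vj ← elemᵇ-toWord⁻ (toℕ x) v (subst T (sym x∈v) _)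
             with () ← v-injective {zero} {suc j} (Fin.toℕ-injective x≡vj)

isPerm-toWord : ∀ {n} (σ : Vec (Fin n) n) → isPerm σ ≡ distinctᵇ (toWord σ)
isPerm-toWord σ =
  T-injective (injective⇒distinctᵇ σ ∘ isPerm⇒injective σ) (injective⇒isPerm σ ∘ distinctᵇ⇒injective σ)

isKing-toWord : ∀ {n} (σ : Vec (Fin n) n) → isKing σ ≡ kingList (toWord σ)
isKing-toWord σ = kingList-map-suc (toWord σ)

count-K : ∀ n (Q : Vec (Fin n) n → Bool) (P : List ℕ → Bool) →
  (∀ σ → Injective _≡_ _≡_ (lookup σ) → Q σ ≡ P (toWord σ)) →
  count Q (K n) ≡ count (λ l → isKingWord l ∧ P l) (words n n)
count-K n Q P Q≡P = begin
  count Q (K n)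
    ≡⟨ count-filterᵇ Q _ (allVecs n n) ⟩
  count (λ σ → (isPerm σ ∧ isKing σ) ∧ Q σ) (allVecs n n)
    ≡⟨ count-cong (allVecs n n) (λ {σ} _ → transfer σ) ⟩
  count ((λ l → isKingWord l ∧ P l) ∘ toWord) (allVecs n n)
    ≡⟨ count-map _ toWord (allVecs n n) ⟨
  count (λ l → isKingWord l ∧ P l) (map toWord (allVecs n n))
    ≡⟨ cong (count (λ l → isKingWord l ∧ P l)) (map-toWord-allVecs n n) ⟩
  count (λ l → isKingWord l ∧ P l) (words n n)
    ∎
  where
  open ≡-Reasoning
  transfer : ∀ σ → (isPerm σ ∧ isKing σ) ∧ Q σ ≡ isKingWord (toWord σ) ∧ P (toWord σ)
  transfer σ rewrite isPerm-toWord σ | isKing-toWord σ with distinctᵇ (toWord σ) in distinct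
  ... | false = refl
  ... | true  = cong (kingList (toWord σ) ∧_) (Q≡P σ (distinctᵇ⇒injective σ (subst T (sym distinct) _)))

-- Occurrences of the pattern

cellEmpty : ∀ {n} → Vec (Fin n) n → ℕ → ℕ → ℕ → ℕ → Bool
cellEmpty {n} σ a b c d = not (any (λ m → (a <ᵇ pos m <ᵇ b) ∧ (c <ᵇ val σ m <ᵇ d)) (allFin n))

cellEmpty-sound : ∀ {n} (σ : Vec (Fin n) n) {a b c d} → T (cellEmpty σ a b c d) →
  ∀ m → a < pos m → pos m < b → c < val σ m → val σ m < d → ⊥
cellEmpty-sound σ {a} {b} {c} {d} empty m a<p p<b c<v v<d = T-not⇒¬T empty (AnyP.any⁺ _ (lose (∈-allFin m) inCell))
  where
  inCell : T ((a <ᵇ pos m <ᵇ b) ∧ (c <ᵇ val σ m <ᵇ d))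
  inCell = Equivalence.from T-∧ ( Equivalence.from T-∧ (ℕ.<⇒<ᵇ a<p , ℕ.<⇒<ᵇ p<b)
                                , Equivalence.from T-∧ (ℕ.<⇒<ᵇ c<v , ℕ.<⇒<ᵇ v<d))

cellEmpty-complete : ∀ {n} (σ : Vec (Fin n) n) a b c d →
  (∀ m → a < pos m → pos m < b → c < val σ m → val σ m < d → ⊥) → T (cellEmpty σ a b c d)
cellEmpty-complete {n} σ a b c d noPoint = ¬T⇒T-not λ nonEmpty →
  let m , inCell = Any.satisfied (AnyP.any⁻ _ (allFin n) nonEmpty)
      column , row = T-∧⁻ (a <ᵇ pos m <ᵇ b) inCell
      a<p , p<b = T-∧⁻ (a <ᵇ pos m) column
      c<v , v<d = T-∧⁻ (c <ᵇ val σ m) row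
  in noPoint m (ℕ.<ᵇ⇒< _ _ a<p) (ℕ.<ᵇ⇒< _ _ p<b) (ℕ.<ᵇ⇒< _ _ c<v) (ℕ.<ᵇ⇒< _ _ v<d)

nothing-between : ∀ {a x} → a < x → x < suc a → ⊥
nothing-between a<x x<1+a = ℕ.<⇒≱ a<x (ℕ.s≤s⁻¹ x<1+a)

-- The lines 0 < p < q < n + 1 of the 3 × 3 grid through two points; isOcc12 R34 σ i j unfolds
-- definitionally to (pos i <ᵇ pos j) ∧ ((val σ i <ᵇ val σ j) ∧ all (cellEmptyAt σ i j) R34).
gridLine : ℕ → ℕ → ℕ → ℕ → ℕ
gridLine n p q 0 = 0
gridLine n p q 1 = p
gridLine n p q 2 = q
gridLine n p q _ = suc n

cellEmptyAt : ∀ {n} → Vec (Fin n) n → Fin n → Fin n → ℕ × ℕ → Bool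
cellEmptyAt {n} σ i j (x , y) =
  cellEmpty σ (gridLine n (pos i) (pos j) x) (gridLine n (pos i) (pos j) (suc x))
              (gridLine n (val σ i) (val σ j) y) (gridLine n (val σ i) (val σ j) (suc y))

pos-injective : ∀ {n} {m k : Fin n} → pos m ≡ pos k → m ≡ k
pos-injective = Fin.toℕ-injective ∘ ℕ.suc-injective

pos<1+n : ∀ {n} (m : Fin n) → pos m < suc n
pos<1+n m = s≤s (Fin.toℕ<n m)

data Strip (a b x : ℕ) : Set where
  below  : x < a → Strip a b x
  inside : a < x → x < b → Strip a b x
  above  : b < x → Strip a b x

strip : ∀ {a b x} → x ≢ a → x ≢ b → Strip a b x
strip {a} {b} {x} x≢a x≢b with ℕ.<-cmp x a
... | tri< x<a _ _ = below x<a
... | tri≈ _ x≡a _ = ⊥-elim (x≢a x≡a)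
... | tri> _ _ a<x with ℕ.<-cmp x b
...   | tri< x<b _ _ = inside a<x x<b
...   | tri≈ _ x≡b _ = ⊥-elim (x≢b x≡b)
...   | tri> _ _ b<x = above b<x

occurrence⇒others-inside : ∀ {n} (σ : Vec (Fin n) n) → Injective _≡_ _≡_ (lookup σ) → ∀ {i j} →
  T (isOcc12 R34 σ i j) → ∀ m → m ≢ i → m ≢ j →
  (pos i < pos m × pos m < pos j) × (val σ i < val σ m × val σ m < val σ j)
occurrence⇒others-inside {n} σ σ-injective {i} {j} occ m m≢i m≢j
  with _ , values∧cells ← T-∧⁻ (pos i <ᵇ pos j) occ
  with _ , cells ← T-∧⁻ (val σ i <ᵇ val σ j) values∧cells
  with e₀₀ ∷ e₀₁ ∷ e₀₂ ∷ e₁₀ ∷ e₁₂ ∷ e₂₀ ∷ e₂₁ ∷ e₂₂ ∷ []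
         ← AllP.all⁺ (cellEmptyAt σ i j) R34 cells
  with strip {pos i} {pos j} (m≢i ∘ pos-injective) (m≢j ∘ pos-injective)
     | strip {val σ i} {val σ j} (m≢i ∘ σ-injective ∘ pos-injective) (m≢j ∘ σ-injective ∘ pos-injective)
... | below p      | below v      = ⊥-elim (cellEmpty-sound σ e₀₀ m z<s p z<s v)
... | below p      | inside v v′  = ⊥-elim (cellEmpty-sound σ e₀₁ m z<s p v v′)
... | below p      | above v      = ⊥-elim (cellEmpty-sound σ e₀₂ m z<s p v (pos<1+n (lookup σ m)))
... | inside p p′  | below v      = ⊥-elim (cellEmpty-sound σ e₁₀ m p p′ z<s v)
... | inside p p′  | inside v v′  = (p , p′) , (v , v′)
... | inside p p′  | above v      = ⊥-elim (cellEmpty-sound σ e₁₂ m p p′ v (pos<1+n (lookup σ m)))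
... | above p      | below v      = ⊥-elim (cellEmpty-sound σ e₂₀ m p (pos<1+n m) z<s v)
... | above p      | inside v v′  = ⊥-elim (cellEmpty-sound σ e₂₁ m p (pos<1+n m) v v′)
... | above p      | above v      = ⊥-elim (cellEmpty-sound σ e₂₂ m p (pos<1+n m) v (pos<1+n (lookup σ m)))

between⇒extremes : ∀ {n} (f : Fin n → ℕ) {i j} → f i < f j →
  (∀ m → m ≢ i → m ≢ j → f i < f m × f m < f j) → ∀ m → f i ≤ f m × f m ≤ f j
between⇒extremes f {i} {j} fi<fj between m with m Fin.≟ i | m Fin.≟ j
... | yes refl | _        = ℕ.≤-refl , ℕ.<⇒≤ fi<fj
... | no _     | yes refl = ℕ.<⇒≤ fi<fj , ℕ.≤-refl
... | no m≢i   | no m≢j   = let fi<fm , fm<fj = between m m≢i m≢j in ℕ.<⇒≤ fi<fm , ℕ.<⇒≤ fm<fj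

injective⇒surjective : ∀ {n} (f : Fin n → Fin n) → Injective _≡_ _≡_ f → ∀ y → ∃ λ m → f m ≡ y
injective⇒surjective {suc n} f f-injective y with Fin.any? (λ m → f m Fin.≟ y)
... | yes hit = hit
... | no miss = ⊥-elim (collision (Fin.pigeonhole ℕ.≤-refl g))
  where
  y≢f : ∀ m → y ≢ f m
  y≢f m y≡fm = miss (m , sym y≡fm)
  g : Fin (suc n) → Fin n
  g m = Fin.punchOut (y≢f m)
  collision : (∃₂ λ i j → i Fin.< j × g i ≡ g j) → ⊥
  collision (i , j , i<j , gi≡gj) =
    ℕ.<-irrefl (cong toℕ (f-injective (Fin.punchOut-injective (y≢f i) (y≢f j) gi≡gj))) i<j

headIs-toWord : ∀ {m k} (σ : Vec (Fin m) (suc k)) c → headIs c (toWord σ) ≡ (toℕ (lookup σ zero) ≡ᵇ c)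
headIs-toWord (x ∷ v) c = refl

lastIs-toWord : ∀ {m} k (σ : Vec (Fin m) (suc k)) c → lastIs c (toWord σ) ≡ (toℕ (lookup σ (fromℕ k)) ≡ᵇ c)
lastIs-toWord zero    (x ∷ [])    c = refl
lastIs-toWord (suc k) (x ∷ y ∷ v) c = lastIs-toWord k (y ∷ v) c

module _ {n′} (σ : Vec (Fin (suc n′)) (suc n′)) where

  occurrence-at-corners : 0 < n′ → toℕ (lookup σ zero) ≡ 0 → toℕ (lookup σ (fromℕ n′)) ≡ n′ →
                          T (isOcc12 R34 σ zero (fromℕ n′))
  occurrence-at-corners 0<n′ first≡0 last≡n′ =
    Equivalence.from T-∧ (ℕ.<⇒<ᵇ (subst (1 <_) (sym pos-last) (s≤s 0<n′)) ,
    Equivalence.from T-∧ (ℕ.<⇒<ᵇ (subst₂ _<_ (sym val-first) (sym val-last) (s≤s 0<n′)) ,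
    AllP.all⁻ (cellEmptyAt σ zero (fromℕ n′)) {xs = R34}
      ( leftColumn 0 first ∷ leftColumn first last ∷ leftColumn last (suc (suc n′))
      ∷ bottomCell ∷ topCell
      ∷ rightColumn 0 first ∷ rightColumn first last ∷ rightColumn last (suc (suc n′)) ∷ [])))
    where
    first last : ℕ
    first = val σ zero
    last  = val σ (fromℕ n′)
    pos-last : pos (fromℕ n′) ≡ suc n′
    pos-last = cong suc (Fin.toℕ-fromℕ n′)
    val-first : val σ zero ≡ 1
    val-first = cong suc first≡0
    val-last : val σ (fromℕ n′) ≡ suc n′
    val-last = cong suc last≡n′
    leftColumn : ∀ c d → T (cellEmpty σ 0 1 c d)
    leftColumn c d = cellEmpty-complete σ 0 1 c d λ m _ p<1 _ _ → nothing-between z<s p<1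
    rightColumn : ∀ c d → T (cellEmpty σ (pos (fromℕ n′)) (suc (suc n′)) c d)
    rightColumn c d = cellEmpty-complete σ (pos (fromℕ n′)) (suc (suc n′)) c d
      λ m last<p p<2+n′ _ _ → nothing-between (subst (_< pos m) pos-last last<p) p<2+n′
    bottomCell : T (cellEmpty σ 1 (pos (fromℕ n′)) 0 (val σ zero))
    bottomCell = cellEmpty-complete σ 1 (pos (fromℕ n′)) 0 first
      λ m _ _ _ v<first → nothing-between z<s (subst (val σ m <_) val-first v<first)
    topCell : T (cellEmpty σ 1 (pos (fromℕ n′)) (val σ (fromℕ n′)) (suc (suc n′)))
    topCell = cellEmpty-complete σ 1 (pos (fromℕ n′)) last (suc (suc n′))
      λ m _ _ last<v v<2+n′ → nothing-between (subst (_< val σ m) val-last last<v) v<2+n′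

  module _ (σ-injective : Injective _≡_ _≡_ (lookup σ)) (i j : Fin (suc n′)) (occ : T (isOcc12 R34 σ i j)) where

    private
      pos-i<pos-j : pos i < pos j
      pos-i<pos-j = ℕ.<ᵇ⇒< _ _ (proj₁ (T-∧⁻ (pos i <ᵇ pos j) occ))

      val-i<val-j : val σ i < val σ j
      val-i<val-j = ℕ.<ᵇ⇒< _ _ (proj₁ (T-∧⁻ (val σ i <ᵇ val σ j) (proj₂ (T-∧⁻ (pos i <ᵇ pos j) occ))))

      pos-extremes : ∀ m → pos i ≤ pos m × pos m ≤ pos j
      pos-extremes = between⇒extremes pos pos-i<pos-j
        (λ m m≢i m≢j → proj₁ (occurrence⇒others-inside σ σ-injective occ m m≢i m≢j))

      val-extremes : ∀ m → val σ i ≤ val σ m × val σ m ≤ val σ j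
      val-extremes = between⇒extremes (val σ) val-i<val-j
        (λ m m≢i m≢j → proj₂ (occurrence⇒others-inside σ σ-injective occ m m≢i m≢j))

      ≥max⇒≡max : ∀ {x} → x ≤ n′ → pos (fromℕ n′) ≤ suc x → x ≡ n′
      ≥max⇒≡max x≤n′ max≤1+x = ℕ.≤-antisym x≤n′ (subst (_≤ _) (Fin.toℕ-fromℕ n′) (ℕ.s≤s⁻¹ max≤1+x))

    occurrence-first : toℕ i ≡ 0
    occurrence-first = ℕ.n≤0⇒n≡0 (ℕ.s≤s⁻¹ (proj₁ (pos-extremes zero)))

    occurrence-last : toℕ j ≡ n′
    occurrence-last = ≥max⇒≡max (Fin.toℕ≤pred[n] j) (proj₂ (pos-extremes (fromℕ n′)))

    occurrence-min : toℕ (lookup σ i) ≡ 0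
    occurrence-min with m , σm≡0 ← injective⇒surjective (lookup σ) σ-injective zero =
      ℕ.n≤0⇒n≡0 (ℕ.s≤s⁻¹ (subst (λ y → val σ i ≤ pos y) σm≡0 (proj₁ (val-extremes m))))

    occurrence-max : toℕ (lookup σ j) ≡ n′
    occurrence-max with m , σm≡max ← injective⇒surjective (lookup σ) σ-injective (fromℕ n′) =
      ≥max⇒≡max (Fin.toℕ≤pred[n] (lookup σ j)) (subst (λ y → pos y ≤ val σ j) σm≡max (proj₂ (val-extremes m)))

    occurrence-long : 0 < n′
    occurrence-long = subst₂ _<_ occurrence-first occurrence-last (ℕ.s≤s⁻¹ pos-i<pos-j)

  minToMax-toWord : minToMax (suc n′) (toWord σ)
                    ≡ (0 <ᵇ n′) ∧ ((toℕ (lookup σ zero) ≡ᵇ 0) ∧ (toℕ (lookup σ (fromℕ n′)) ≡ᵇ n′))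
  minToMax-toWord = cong₂ (λ h l → (0 <ᵇ n′) ∧ (h ∧ l)) (headIs-toWord σ 0) (lastIs-toWord n′ σ n′)

  isOcc12-R34 : Injective _≡_ _≡_ (lookup σ) → ∀ i j →
    isOcc12 R34 σ i j ≡ ((toℕ i ≡ᵇ 0) ∧ (toℕ j ≡ᵇ n′)) ∧ minToMax (suc n′) (toWord σ)
  isOcc12-R34 σ-injective i j = T-injective forward backward
    where
    forward : T (isOcc12 R34 σ i j) → T (((toℕ i ≡ᵇ 0) ∧ (toℕ j ≡ᵇ n′)) ∧ minToMax (suc n′) (toWord σ))
    forward occ = Equivalence.from T-∧
      ( Equivalence.from T-∧ (ℕ.≡⇒≡ᵇ _ _ first , ℕ.≡⇒≡ᵇ _ _ last)
      , subst T (sym minToMax-toWord) (Equivalence.from T-∧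
          ( ℕ.<⇒<ᵇ (occurrence-long σ-injective i j occ)
          , Equivalence.from T-∧ (ℕ.≡⇒≡ᵇ _ _ min , ℕ.≡⇒≡ᵇ _ _ max))))
      where
      first = occurrence-first σ-injective i j occ
      last  = occurrence-last σ-injective i j occ
      min : toℕ (lookup σ zero) ≡ 0
      min = subst (λ k → toℕ (lookup σ k) ≡ 0) (Fin.toℕ-injective first) (occurrence-min σ-injective i j occ)
      max : toℕ (lookup σ (fromℕ n′)) ≡ n′
      max = subst (λ k → toℕ (lookup σ k) ≡ n′) (Fin.toℕ-injective (trans last (sym (Fin.toℕ-fromℕ n′))))
                  (occurrence-max σ-injective i j occ)
    backward : T (((toℕ i ≡ᵇ 0) ∧ (toℕ j ≡ᵇ n′)) ∧ minToMax (suc n′) (toWord σ)) → T (isOcc12 R34 σ i j)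
    backward corners∧minToMax =
      let corners , long∧ends = T-∧⁻ ((toℕ i ≡ᵇ 0) ∧ (toℕ j ≡ᵇ n′)) corners∧minToMax
          first , last        = T-∧⁻ (toℕ i ≡ᵇ 0) corners
          long , ends         = T-∧⁻ (0 <ᵇ n′) (subst T minToMax-toWord long∧ends)
          min , max           = T-∧⁻ (toℕ (lookup σ zero) ≡ᵇ 0) ends
      in subst₂ (λ i j → T (isOcc12 R34 σ i j))
                (sym (Fin.toℕ-injective {i = i} {j = zero} (ℕ.≡ᵇ⇒≡ (toℕ i) 0 first)))
                (sym (Fin.toℕ-injective (trans (ℕ.≡ᵇ⇒≡ (toℕ j) n′ last) (sym (Fin.toℕ-fromℕ n′)))))
                (occurrence-at-corners (ℕ.<ᵇ⇒< 0 n′ long) (ℕ.≡ᵇ⇒≡ _ 0 min) (ℕ.≡ᵇ⇒≡ _ n′ max))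

count-pairs : ∀ (φ : X → Bool) (ψ : Y → Bool) xs ys →
  count (λ ij → φ (proj₁ ij) ∧ ψ (proj₂ ij)) (concatMap (λ i → map (i ,_) ys) xs) ≡ count φ xs ℕ.* count ψ ys
count-pairs φ ψ []       ys = refl
count-pairs φ ψ (x ∷ xs) ys with φ x in φx
... | true  = trans (count-++ φψ (map (x ,_) ys) _) (cong₂ ℕ._+_
                (trans (count-map φψ (x ,_) ys) (count-cong ys λ _ → cong (_∧ _) φx)) (count-pairs φ ψ xs ys))
  where φψ = λ ij → φ (proj₁ ij) ∧ ψ (proj₂ ij)
... | false = trans (count-++ φψ (map (x ,_) ys) _) (cong₂ ℕ._+_
                (trans (count-map φψ (x ,_) ys) (count-none ys λ _ → cong (_∧ _) φx)) (count-pairs φ ψ xs ys))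
  where φψ = λ ij → φ (proj₁ ij) ∧ ψ (proj₂ ij)

count-tabulate-suc : ∀ n {p : Fin (suc n) → Bool} → count p (tabulate suc) ≡ count (p ∘ suc) (allFin n)
count-tabulate-suc n {p} = trans (cong (count p) (sym (map-tabulate id suc))) (count-map p suc (allFin n))

count-toℕ≡ : ∀ n c → c < n → count (λ i → toℕ i ≡ᵇ c) (allFin n) ≡ 1
count-toℕ≡ (suc n) zero    _         =
  cong suc (trans (count-tabulate-suc n) (count-none (allFin n) λ _ → refl))
count-toℕ≡ (suc n) (suc c) (s≤s c<n) = trans (count-tabulate-suc n) (count-toℕ≡ n c c<n)

occ12-R34 : ∀ {n} (σ : Vec (Fin n) n) → Injective _≡_ _≡_ (lookup σ) →
  occ12 R34 σ ≡ (if minToMax n (toWord σ) then 1 else 0)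
occ12-R34 {zero}   []  _           = refl
occ12-R34 {suc n′} σ σ-injective =
  trans (count-cong pairs λ {ij} _ → isOcc12-R34 σ σ-injective (proj₁ ij) (proj₂ ij))
        (onlyCorners (minToMax (suc n′) (toWord σ)))
  where
  pairs = concatMap (λ i → map (i ,_) (allFin (suc n′))) (allFin (suc n′))
  onlyCorners : ∀ b → count (λ ij → ((toℕ (proj₁ ij) ≡ᵇ 0) ∧ (toℕ (proj₂ ij) ≡ᵇ n′)) ∧ b) pairs
                    ≡ (if b then 1 else 0)
  onlyCorners false = count-none pairs λ _ → ∧-zeroʳ _
  onlyCorners true  =
    trans (count-cong pairs λ _ → ∧-identityʳ _)
          (trans (count-pairs (λ i → toℕ i ≡ᵇ 0) (λ j → toℕ j ≡ᵇ n′) (allFin (suc n′)) (allFin (suc n′)))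
                 (cong₂ ℕ._*_ (count-toℕ≡ (suc n′) 0 z<s) (count-toℕ≡ (suc n′) n′ ℕ.≤-refl)))

-- The generating functions

C B : Series
C n = + kingsEndingAtMax n
B n = + kingsFromMinToMax n

A≡kings : ∀ n → A n ≡ + kings n
A≡kings n = cong +_ (begin
  length (K n)                                      ≡⟨ count-true (K n) ⟨
  count (const true) (K n)                          ≡⟨ count-K n (const true) (const true) (λ _ _ → refl) ⟩
  count (λ l → isKingWord l ∧ true) (words n n)     ≡⟨ count-cong (words n n) (λ _ → ∧-identityʳ _) ⟩
  kings n                                           ∎)
  where open ≡-Reasoning

E≡count : ∀ n k → E n k ≡ + count (λ l → isKingWord l ∧ ((if minToMax n l then 1 else 0) ≡ᵇ k)) (words n n)
E≡count n k = cong +_ (count-K n _ _ λ σ σ-injective → cong (_≡ᵇ k) (occ12-R34 σ σ-injective))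

E-column-0+B : ∀ n → E n 0 + B n ≡ A n
E-column-0+B n = begin
  E n 0 + B n
    ≡⟨ cong (_+ B n) (trans (E≡count n 0)
         (cong +_ (count-cong (words n n) λ {l} _ → cong (isKingWord l ∧_) (is0 (minToMax n l))))) ⟩
  + count (λ l → isKingWord l ∧ not (minToMax n l)) (words n n) + B n
    ≡⟨ ℤ.pos-+ _ (kingsFromMinToMax n) ⟨
  + (count (λ l → isKingWord l ∧ not (minToMax n l)) (words n n) ℕ.+ kingsFromMinToMax n)
    ≡⟨ cong +_ (trans (ℕ.+-comm _ (kingsFromMinToMax n))
                      (sym (count-split isKingWord (minToMax n) (words n n)))) ⟩
  + kings n
    ≡⟨ A≡kings n ⟨
  A n
    ∎
  where
  open ≡-Reasoning
  is0 : ∀ b → ((if b then 1 else 0) ≡ᵇ 0) ≡ not b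
  is0 true  = refl
  is0 false = refl

E-column-1 : ∀ n → E n 1 ≡ B n
E-column-1 n = trans (E≡count n 1)
  (cong +_ (count-cong (words n n) λ {l} _ → cong (isKingWord l ∧_) (is1 (minToMax n l))))
  where
  is1 : ∀ b → ((if b then 1 else 0) ≡ᵇ 1) ≡ b
  is1 true  = refl
  is1 false = refl

E-column-2+ : ∀ n k → E n (suc (suc k)) ≡ + 0
E-column-2+ n k = trans (E≡count n (suc (suc k)))
  (cong +_ (count-none (words n n) λ l → never (isKingWord l) (minToMax n l)))
  where
  never : ∀ a b → a ∧ ((if b then 1 else 0) ≡ᵇ suc (suc k)) ≡ false
  never a true  = ∧-zeroʳ a
  never a false = ∧-zeroʳ a

C-closed : C ≗ div1+t (shift A)
C-closed = div1+t-unique C (shift A) refl λ n →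
  trans (sym (ℤ.pos-+ (kingsEndingAtMax (suc n)) (kingsEndingAtMax n)))
        (trans (cong +_ (kingsEndingAtMax-rec n)) (sym (A≡kings n)))

-- The correction −t² comes from n = 1: the permutation 1 ends at its maximum, but 1 2 is not king.
B-recurrence : B ≗ div1+t (shift C ⊕ neg t²)
B-recurrence = div1+t-unique B (shift C ⊕ neg t²) refl step
  where
  step : ∀ n → B (suc n) + B n ≡ (shift C ⊕ neg t²) (suc n)
  step zero          = refl
  step (suc zero)    = refl
  step (suc (suc m)) = trans (sym (ℤ.pos-+ (kingsFromMinToMax (3 ℕ.+ m)) (kingsFromMinToMax (2 ℕ.+ m))))
                             (trans (cong +_ (kingsFromMinToMax-rec m)) (sym (ℤ.+-identityʳ _)))

B-closed : B ≗ div1+t (neg t²) ⊕ div1+t (div1+t (t² ⊛ A))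
B-closed n = begin
  B n                                                   ≡⟨ B-recurrence n ⟩
  div1+t (shift C ⊕ neg t²) n                           ≡⟨ div1+t-⊕ (shift C) (neg t²) n ⟩
  div1+t (shift C) n + div1+t (neg t²) n                ≡⟨ ℤ.+-comm (div1+t (shift C) n) (div1+t (neg t²) n) ⟩
  div1+t (neg t²) n + div1+t (shift C) n                ≡⟨ cong (_+_ (div1+t (neg t²) n)) (div1+t-cong shiftC n) ⟩
  div1+t (neg t²) n + div1+t (div1+t (t² ⊛ A)) n        ∎
  where
  open ≡-Reasoning
  shiftC : shift C ≗ div1+t (t² ⊛ A)
  shiftC m = begin
    shift C m                      ≡⟨ shift-cong C-closed m ⟩
    shift (div1+t (shift A)) m     ≡⟨ div1+t-shift (shift A) m ⟨
    div1+t (shift (shift A)) m     ≡⟨ div1+t-cong (t²-⊛ A) m ⟨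
    div1+t (t² ⊛ A) m              ∎

E-column-0-closed : ∀ n → E n 0 ≡ div1+t t² n + div1+t (div1+t (1+2t ⊛ A)) n
E-column-0-closed n = begin
  E n 0                                           ≡⟨ cancel (E n 0) (B n) ⟩
  E n 0 + B n - B n                               ≡⟨ cong₂ _-_ (trans (E-column-0+B n) (square-split A n))
                                                               (trans (B-closed n) (cong (_+ y) (div1+t-neg t² n))) ⟩
  x + y - (- z + y)                               ≡⟨ rearrange x y z ⟩
  z + x                                           ∎
  where
  open ≡-Reasoning
  x = div1+t (div1+t (1+2t ⊛ A)) n
  y = div1+t (div1+t (t² ⊛ A)) n
  z = div1+t t² n
  cancel : ∀ a b → a ≡ a + b - b
  cancel = solve-∀
  rearrange : ∀ x y z → x + y - (- z + y) ≡ z + x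
  rearrange = solve-∀

theorem3p4 : (∀ n → P n ≡ (poly (+ 0 ∷ + 0 ∷ + 1 ∷ []) ⊛ inv1+t
    ⊕ poly (+ 1 ∷ + 2 ∷ []) ⊛ A ⊛ inv1+t ⊛ inv1+t) n)
    × (∀ n k → E n k ≡ (lift (poly (+ 0 ∷ + 0 ∷ + 1 ∷ [])) ⊠ (lift (poly (+ 1 ∷ [])) ⊞ lift (poly (- + 1 ∷ [])) ⊠ uB) ⊠ lift inv1+t
    ⊞ (lift (poly (+ 1 ∷ + 2 ∷ [])) ⊞ uB ⊠ lift (poly (+ 0 ∷ + 0 ∷ + 1 ∷ []))) ⊠ lift A ⊠ lift inv1+t ⊠ lift inv1+t) n k)
-- P n is E n 0 by definition.
theorem3p4 = (λ n → trans (E-column-0-closed n) (sym (closedP-as-div1+t n))) , E-formula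
  where
  E-formula : ∀ n k → E n k ≡ closedE n k
  E-formula n zero          = trans (E-column-0-closed n) (sym (closedE-column-0 n))
  E-formula n (suc zero)    = trans (E-column-1 n) (trans (B-closed n) (sym (closedE-column-1 n)))
  E-formula n (suc (suc k)) = trans (E-column-2+ n k) (sym (closedE-column-2+ k n))
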